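{- Let $P$ be a Łukasiewicz path and $T=\tau(P)$ the corresponding plane tree. Then $\mathrm{area}(P)=\mathrm{rthorn}(T)$.
   Context: A Łukasiewicz path is a finite lattice path in $\mathbb{Z}^2$ starting at $(0,0)$, using steps $(1,k)$ with $k\ge -1$, such that every point except the final endpoint has nonnegative $y$-coordinate and the last step is $(1,-1)$. Write $D=(1,-1)$ and $U_k=(1,k)$ for $k\ge 0$ (up-step of degree $k$). $\mathrm{area}(P)$ is the sum, over all up-steps of $P$, of the $y$-coordinate of the starting point of the up-step. A plane tree is a rooted tree in which the children of each node are linearly ordered left to right; internal nodes are nodes with at least one child, leaves are the others. The bijection $\tau$ from Łukasiewicz paths to plane trees: start with a single empty slot ("bud"); read $P$ from left to right, and on reading $U_k$ replace the leftmost empty bud by an internal node with $k+1$ empty buds as children (in order), and on reading $D$ replace the leftmost empty bud by a leaf. Its inverse $\lambda$ lists the nodes of a plane tree in preorder (left-to-right contour walk from the root, at first visit), writing $D$ for a leaf and $U_k$ for an internal node with $k+1$ children. Thorns: for an internal node $u$ of a plane tree $T$, an edge $e$ is a right thorn of $u$ if there is an ancestor $v\ne u$ of $u$ such that $e$ joins $v$ to a child of $v$ lying strictly to the right of the child of $v$ on the path from $v$ to $u$ (left thorns are defined symmetrically, with "left"). $\mathrm{rthorn}(u)$ is the number of right thorns of $u$, and $\mathrm{rthorn}(T)$ is the sum of $\mathrm{rthorn}(u)$ over all internal nodes $u$ of $T$. -}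

module Defs where

open import Data.Nat using (ℕ; zero; suc; _+_)
open import Data.Integer as ℤ using (ℤ; +_; -[1+_]) renaming (_+_ to _+ℤ_; _≤_ to _≤ℤ_)
open import Data.List using (List; []; _∷_; _++_; [_]; length)
open import Data.List.Relation.Unary.All using (All)
open import Data.Maybe using (Maybe; just; nothing)
open import Data.Product using (Σ; _×_; ∃)
open import Relation.Binary.PropositionalEquality using (_≡_)

-- A step: D = (1,-1), U k = (1,k) for k ≥ 0.
data Step : Set where
  D : Step
  U : ℕ → Step

δ : Step → ℤ
δ D     = -[1+ 0 ]
δ (U k) = + k

points : ℤ → List Step → List ℤ
points h []       = h ∷ []
points h (s ∷ ss) = h ∷ points (h +ℤ δ s) ss

endHeight : ℤ → List Step → ℤ
endHeight h []       = h
endHeight h (s ∷ ss) = endHeight (h +ℤ δ s) ss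

IsŁuk : List Step → Set
IsŁuk P = Σ (List Step) λ Q →
  (P ≡ Q ++ [ D ]) × All (λ y → + 0 ≤ℤ y) (points (+ 0) Q) × (endHeight (+ 0) P ≡ -[1+ 0 ])

areaFrom : ℤ → List Step → ℤ
areaFrom h []           = + 0
areaFrom h (D ∷ ss)     = areaFrom (h +ℤ δ D) ss
areaFrom h (U k ∷ ss)   = h +ℤ areaFrom (h +ℤ + k) ss

area : List Step → ℤ
area = areaFrom (+ 0)

data Tree : Set where
  node : List Tree → Tree

data PTree : Set where
  bud   : PTree
  pnode : List PTree → PTree

mutual
  fill : PTree → PTree → Maybe PTree
  fill bud        t = just t
  fill (pnode cs) t with fillList cs t
  ... | just cs' = just (pnode cs')
  ... | nothing  = nothing

  fillList : List PTree → PTree → Maybe (List PTree)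
  fillList []       t = nothing
  fillList (c ∷ cs) t with fill c t
  ... | just c' = just (c' ∷ cs)
  ... | nothing with fillList cs t
  ...   | just cs' = just (c ∷ cs')
  ...   | nothing  = nothing

buds : ℕ → List PTree
buds zero    = []
buds (suc n) = bud ∷ buds n

stepTree : Step → PTree
stepTree D     = pnode []
stepTree (U k) = pnode (buds (suc k))

run : PTree → List Step → Maybe PTree
run t []       = just t
run t (s ∷ ss) with fill t (stepTree s)
... | just t' = run t' ss
... | nothing = nothing

mutual
  complete : PTree → Maybe Tree
  complete bud        = nothing
  complete (pnode cs) with completeList cs
  ... | just ts = just (node ts)
  ... | nothing = nothing

  completeList : List PTree → Maybe (List Tree)
  completeList []       = just []
  completeList (c ∷ cs) with complete c | completeList cs
  ... | just t | just ts = just (t ∷ ts)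
  ... | _      | _       = nothing

τ : List Step → Maybe Tree
τ P with run bud P
... | just t  = complete t
... | nothing = nothing

-- Right thorns.
-- rthornFrom a T: T is a subtree rooted at node u, and a is the number of
-- right thorns coming from the proper ancestors of u (i.e. the sum, over
-- proper ancestors v of u, of the number of children of v strictly to the
-- right of the child of v on the path to u).  It returns the sum of
-- rthorn(w) over all internal nodes w of the subtree.


mutual
  rthornFrom : ℕ → Tree → ℕ
  rthornFrom a (node [])       = 0
  rthornFrom a (node (c ∷ cs)) = a + rthornChildren a (c ∷ cs)

  -- children listed left to right; the child c has (length cs) siblings to
  -- its right, each giving a right thorn to every internal node below c
  rthornChildren : ℕ → List Tree → ℕ
  rthornChildren a []       = 0
  rthornChildren a (c ∷ cs) = rthornFrom (a + length cs) c + rthornChildren a cs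

rthorn : Tree → ℕ
rthorn = rthornFrom 0

-- Reading a step fills the leftmost bud, i.e. the first hole of the preorder word of the
-- partial tree; the holes always form a suffix of that word, so τ P = T forces P = λ T.
-- Along λ T, the height before the step of a node u is the number of subtrees still pending,
-- namely the children lying right of the path to u at each proper ancestor: these are the
-- right thorns of u, so summing heights over up-steps gives area (λ T) = rthorn T.
module Submission where

open import Defs
open import Data.List using (List)
open import Data.Maybe using (just)
open import Data.Integer using (+_)
open import Relation.Binary.PropositionalEquality using (_≡_)

open import Data.Nat using (ℕ; zero; suc; _+_)
open import Data.Integer using (-[1+_]) renaming (_+_ to _+ℤ_)
open import Data.Integer.Properties using (+-identityˡ; +-identityʳ; +-assoc)
open import Data.List using ([]; _∷_; _++_; [_]; length; map; replicate)
open import Data.List.Properties using (map-++; ++-identityʳ; ++-assoc; ∷-injectiveˡ; ∷-injectiveʳ)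
open import Data.Maybe using (Maybe; nothing; _>>=_)
import Data.Maybe as Maybe
import Data.Maybe.Properties as Maybe
open import Data.Product using (∃; _,_)
open import Relation.Binary.PropositionalEquality
  using (refl; sym; trans; cong; cong₂; module ≡-Reasoning)

open ≡-Reasoning

arityStep : ℕ → Step
arityStep zero    = D
arityStep (suc k) = U k

mutual
  preorder : Tree → List Step
  preorder (node ts) = arityStep (length ts) ∷ preorderForest ts

  preorderForest : List Tree → List Step
  preorderForest []       = []
  preorderForest (t ∷ ts) = preorder t ++ preorderForest ts

endHeight-++ : ∀ h xs ys → endHeight h (xs ++ ys) ≡ endHeight (endHeight h xs) ys
endHeight-++ h []       ys = refl
endHeight-++ h (s ∷ xs) ys = endHeight-++ (h +ℤ δ s) xs ys

areaFrom-++ : ∀ h xs ys → areaFrom h (xs ++ ys) ≡ areaFrom h xs +ℤ areaFrom (endHeight h xs) ys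
areaFrom-++ h []         ys = sym (+-identityˡ _)
areaFrom-++ h (D ∷ xs)   ys = areaFrom-++ (h +ℤ δ D) xs ys
areaFrom-++ h (U k ∷ xs) ys = begin
  h +ℤ areaFrom (h +ℤ + k) (xs ++ ys)
    ≡⟨ cong (h +ℤ_) (areaFrom-++ (h +ℤ + k) xs ys) ⟩
  h +ℤ (areaFrom (h +ℤ + k) xs +ℤ areaFrom (endHeight (h +ℤ + k) xs) ys)
    ≡⟨ sym (+-assoc h _ _) ⟩
  h +ℤ areaFrom (h +ℤ + k) xs +ℤ areaFrom (endHeight (h +ℤ + k) xs) ys ∎

+-suc-pred : ∀ h m → h +ℤ + suc m +ℤ -[1+ 0 ] ≡ h +ℤ + m
+-suc-pred h m = +-assoc h (+ suc m) -[1+ 0 ]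

+-δ-arityStep : ∀ h n → h +ℤ δ (arityStep n) ≡ h +ℤ -[1+ 0 ] +ℤ + n
+-δ-arityStep h zero    = sym (+-identityʳ _)
+-δ-arityStep h (suc k) = sym (+-assoc h -[1+ 0 ] (+ suc k))

mutual
  endHeight-preorder : ∀ h t → endHeight h (preorder t) ≡ h +ℤ -[1+ 0 ]
  endHeight-preorder h (node ts) = begin
    endHeight (h +ℤ δ (arityStep (length ts))) (preorderForest ts)
      ≡⟨ cong (λ x → endHeight x (preorderForest ts)) (+-δ-arityStep h (length ts)) ⟩
    endHeight (h +ℤ -[1+ 0 ] +ℤ + length ts) (preorderForest ts)
      ≡⟨ endHeight-preorderForest (h +ℤ -[1+ 0 ]) ts ⟩
    h +ℤ -[1+ 0 ] ∎

  endHeight-preorderForest : ∀ h ts → endHeight (h +ℤ + length ts) (preorderForest ts) ≡ h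
  endHeight-preorderForest h []       = +-identityʳ h
  endHeight-preorderForest h (t ∷ ts) = begin
    endHeight h′ (preorder t ++ preorderForest ts)
      ≡⟨ endHeight-++ h′ (preorder t) (preorderForest ts) ⟩
    endHeight (endHeight h′ (preorder t)) (preorderForest ts)
      ≡⟨ cong (λ x → endHeight x (preorderForest ts)) (endHeight-preorder h′ t) ⟩
    endHeight (h′ +ℤ -[1+ 0 ]) (preorderForest ts)
      ≡⟨ cong (λ x → endHeight x (preorderForest ts)) (+-suc-pred h (length ts)) ⟩
    endHeight (h +ℤ + length ts) (preorderForest ts)
      ≡⟨ endHeight-preorderForest h ts ⟩
    h ∎
    where h′ = h +ℤ + suc (length ts)

mutual
  area-preorder : ∀ a t → areaFrom (+ a) (preorder t) ≡ + rthornFrom a t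
  area-preorder a (node [])       = refl
  area-preorder a (node (t ∷ ts)) = cong (+ a +ℤ_) (begin
    areaFrom (+ a +ℤ + length ts) (preorderForest (t ∷ ts))
      ≡⟨ cong (λ h → areaFrom h (preorderForest (t ∷ ts))) (+-δ-arityStep (+ a) (suc (length ts))) ⟩
    areaFrom (+ a +ℤ -[1+ 0 ] +ℤ + length (t ∷ ts)) (preorderForest (t ∷ ts))
      ≡⟨ area-preorderForest a (t ∷ ts) ⟩
    + rthornChildren a (t ∷ ts) ∎)

  area-preorderForest : ∀ a ts →
    areaFrom (+ a +ℤ -[1+ 0 ] +ℤ + length ts) (preorderForest ts) ≡ + rthornChildren a ts
  area-preorderForest a []       = refl
  area-preorderForest a (t ∷ ts) = begin
    areaFrom h (preorder t ++ preorderForest ts)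
      ≡⟨ areaFrom-++ h (preorder t) (preorderForest ts) ⟩
    areaFrom h (preorder t) +ℤ areaFrom (endHeight h (preorder t)) (preorderForest ts)
      ≡⟨ cong₂ _+ℤ_ first (cong (λ x → areaFrom x (preorderForest ts)) (endHeight-preorder h t)) ⟩
    + rthornFrom (a + length ts) t +ℤ areaFrom (h +ℤ -[1+ 0 ]) (preorderForest ts)
      ≡⟨ cong (λ x → + rthornFrom (a + length ts) t +ℤ areaFrom x (preorderForest ts))
              (+-suc-pred (+ a +ℤ -[1+ 0 ]) (length ts)) ⟩
    + rthornFrom (a + length ts) t +ℤ areaFrom (+ a +ℤ -[1+ 0 ] +ℤ + length ts) (preorderForest ts)
      ≡⟨ cong (+ rthornFrom (a + length ts) t +ℤ_) (area-preorderForest a ts) ⟩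
    + rthornChildren a (t ∷ ts) ∎
    where
    h = + a +ℤ -[1+ 0 ] +ℤ + suc (length ts)
    first : areaFrom h (preorder t) ≡ + rthornFrom (a + length ts) t
    first = trans (cong (λ x → areaFrom x (preorder t)) (sym (+-δ-arityStep (+ a) (suc (length ts)))))
                  (area-preorder (a + length ts) t)

holes : ℕ → List (Maybe Step)
holes n = replicate n nothing

mutual
  word : PTree → List (Maybe Step)
  word bud        = [ nothing ]
  word (pnode ts) = just (arityStep (length ts)) ∷ wordForest ts

  wordForest : List PTree → List (Maybe Step)
  wordForest []       = []
  wordForest (t ∷ ts) = word t ++ wordForest ts

plug : List (Maybe Step) → List (Maybe Step) → Maybe (List (Maybe Step))
plug []            v = nothing
plug (nothing ∷ w) v = just (v ++ w)
plug (just s ∷ w)  v = Maybe.map (just s ∷_) (plug w v)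

plug-++-just : ∀ w u v {w′} → plug w v ≡ just w′ → plug (w ++ u) v ≡ just (w′ ++ u)
plug-++-just (nothing ∷ w) u v refl = cong just (sym (++-assoc v w u))
plug-++-just (just s ∷ w)  u v eq with plug w v in e
plug-++-just (just s ∷ w)  u v refl | just w′ = cong (Maybe.map (just s ∷_)) (plug-++-just w u v e)

plug-++-nothing : ∀ w u v → plug w v ≡ nothing → plug (w ++ u) v ≡ Maybe.map (w ++_) (plug u v)
plug-++-nothing []           u v _  = sym (Maybe.map-id (plug u v))
plug-++-nothing (just s ∷ w) u v eq with plug w v in e
... | nothing = trans (cong (Maybe.map (just s ∷_)) (plug-++-nothing w u v e)) (sym (Maybe.map-∘ (plug u v)))

fillList-length : ∀ ts x {ts′} → fillList ts x ≡ just ts′ → length ts′ ≡ length ts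
fillList-length (t ∷ ts) x eq with fill t x
fillList-length (t ∷ ts) x refl | just t′ = refl
... | nothing with fillList ts x in e
fillList-length (t ∷ ts) x refl | nothing | just ts′ = cong suc (fillList-length ts x e)

mutual
  fill-word : ∀ t x → Maybe.map word (fill t x) ≡ plug (word t) (word x)
  fill-word bud        x = cong just (sym (++-identityʳ (word x)))
  fill-word (pnode ts) x with fillList ts x in e | fillList-wordForest ts x
  ... | just ts′ | ih rewrite fillList-length ts x e = cong (Maybe.map (just (arityStep (length ts)) ∷_)) ih
  ... | nothing  | ih = cong (Maybe.map (just (arityStep (length ts)) ∷_)) ih

  fillList-wordForest : ∀ ts x → Maybe.map wordForest (fillList ts x) ≡ plug (wordForest ts) (word x)
  fillList-wordForest []       x = refl
  fillList-wordForest (t ∷ ts) x with fill t x | fill-word t x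
  ... | just t′ | ih = sym (plug-++-just (word t) (wordForest ts) (word x) (sym ih))
  ... | nothing | ih with fillList ts x | fillList-wordForest ts x
  ...   | just ts′ | ih′ = trans (cong (Maybe.map (word t ++_)) ih′)
                             (sym (plug-++-nothing (word t) (wordForest ts) (word x) (sym ih)))
  ...   | nothing  | ih′ = trans (cong (Maybe.map (word t ++_)) ih′)
                             (sym (plug-++-nothing (word t) (wordForest ts) (word x) (sym ih)))

children : Step → ℕ
children D     = 0
children (U k) = suc k

stepWord : Step → List (Maybe Step)
stepWord s = just s ∷ holes (children s)

wordForest-buds : ∀ n → wordForest (buds n) ≡ holes n
wordForest-buds zero    = refl
wordForest-buds (suc n) = cong (nothing ∷_) (wordForest-buds n)

length-buds : ∀ n → length (buds n) ≡ n
length-buds zero    = refl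
length-buds (suc n) = cong suc (length-buds n)

word-stepTree : ∀ s → word (stepTree s) ≡ stepWord s
word-stepTree D     = refl
word-stepTree (U k) = cong₂ (λ n w → just (arityStep n) ∷ w) (length-buds (suc k)) (wordForest-buds (suc k))

plugs : List (Maybe Step) → List Step → Maybe (List (Maybe Step))
plugs w []       = just w
plugs w (s ∷ ss) = plug w (stepWord s) >>= λ w′ → plugs w′ ss

run-word : ∀ t P → Maybe.map word (run t P) ≡ plugs (word t) P
run-word t []       = refl
run-word t (s ∷ ss) with fill t (stepTree s) | fill-word t (stepTree s)
... | just t′ | eq rewrite word-stepTree s | sym eq = run-word t′ ss
... | nothing | eq rewrite word-stepTree s | sym eq = refl

holes-++ : ∀ m n → holes m ++ holes n ≡ holes (m + n)
holes-++ zero    n = refl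
holes-++ (suc m) n = cong (nothing ∷_) (holes-++ m n)

plugs-just-∷ : ∀ s w ss → plugs (just s ∷ w) ss ≡ Maybe.map (just s ∷_) (plugs w ss)
plugs-just-∷ s w []        = refl
plugs-just-∷ s w (s′ ∷ ss) with plug w (stepWord s′)
... | just w′ = plugs-just-∷ s w′ ss
... | nothing = refl

plugs-holes : ∀ n P {w} → plugs (holes n) P ≡ just w → ∃ λ m → w ≡ map just P ++ holes m
plugs-holes n       []       refl = n , refl
plugs-holes (suc n) (s ∷ ss) eq
  rewrite plugs-just-∷ s (holes (children s) ++ holes n) ss | holes-++ (children s) n
  with plugs (holes (children s + n)) ss in e
... | just w′ with refl ← eq = let m , w′≡ = plugs-holes (children s + n) ss e in m , cong (just s ∷_) w′≡

map-just-++-holes-injective : ∀ {P Q : List Step} n → map just P ++ holes n ≡ map just Q → P ≡ Q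
map-just-++-holes-injective {[]}    {[]}    n       eq = refl
map-just-++-holes-injective {[]}    {_ ∷ _} zero    ()
map-just-++-holes-injective {[]}    {_ ∷ _} (suc n) ()
map-just-++-holes-injective {_ ∷ _} {[]}    n       ()
map-just-++-holes-injective {s ∷ P} {s′ ∷ Q} n eq with refl ← ∷-injectiveˡ eq =
  cong (s ∷_) (map-just-++-holes-injective n (∷-injectiveʳ eq))

completeList-length : ∀ ts {Ts} → completeList ts ≡ just Ts → length ts ≡ length Ts
completeList-length []       refl = refl
completeList-length (t ∷ ts) eq with complete t | completeList ts in e
... | just T  | just Ts with refl ← eq = cong suc (completeList-length ts e)
... | just T  | nothing with () ← eq
... | nothing | _ with () ← eq

mutual
  complete-word : ∀ t {T} → complete t ≡ just T → word t ≡ map just (preorder T)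
  complete-word bud        ()
  complete-word (pnode ts) eq with completeList ts in e
  ... | just Ts with refl ← eq =
    cong₂ (λ n w → just (arityStep n) ∷ w) (completeList-length ts e) (completeList-wordForest ts e)

  completeList-wordForest : ∀ ts {Ts} → completeList ts ≡ just Ts → wordForest ts ≡ map just (preorderForest Ts)
  completeList-wordForest []       refl = refl
  completeList-wordForest (t ∷ ts) eq with complete t in e₁ | completeList ts in e₂
  ... | just T  | just Ts with refl ← eq = begin
    word t ++ wordForest ts
      ≡⟨ cong₂ _++_ (complete-word t e₁) (completeList-wordForest ts e₂) ⟩
    map just (preorder T) ++ map just (preorderForest Ts)
      ≡⟨ sym (map-++ just (preorder T) (preorderForest Ts)) ⟩
    map just (preorder T ++ preorderForest Ts) ∎
  ... | just T  | nothing with () ← eq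
  ... | nothing | _       with () ← eq

τ≡just⇒≡preorder : ∀ P {T} → τ P ≡ just T → P ≡ preorder T
τ≡just⇒≡preorder P τP≡T with run bud P in run≡t
... | just t =
  let m , word-t = plugs-holes 1 P (trans (sym (run-word bud P)) (cong (Maybe.map word) run≡t))
  in  map-just-++-holes-injective m (trans (sym word-t) (complete-word t τP≡T))

proposition3p3 : (P : List Step) (T : Tree) → IsŁuk P → τ P ≡ just T → area P ≡ + rthorn T
proposition3p3 P T _ τP≡T = begin
  area P             ≡⟨ cong area (τ≡just⇒≡preorder P τP≡T) ⟩
  area (preorder T)  ≡⟨ area-preorder 0 T ⟩
  + rthorn T         ∎
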